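{- Let $G$ be a strongly connected directed graph that is not a cycle, and let $W$ be a walk in $G$ with univocal extension $U(W)$. Then $U(W)$ is safe if and only if $W$ is safe, and $U(W)$ is multi-safe if and only if $W$ is multi-safe.
   Context: "$G$ is a cycle" means $G$ consists of a single directed cycle through all its nodes. A walk is a sequence of nodes with consecutive pairs being arcs; closed if its first and last node coincide; a proper closed walk is a closed walk of positive length. Subwalks are contiguous subsequences (for closed walks they may wrap around the end). A split is a node with at least two outgoing arcs; a join is a node with at least two incoming arcs. The univocal extension of $W=(w_1,\dots,w_\ell)$ is the maximal walk $U(W)=(l_1,\dots,l_a,w_1,\dots,w_\ell,r_1,\dots,r_b)$ such that $l_2,\dots,l_a,w_1$ are not joins and $w_\ell,r_1,\dots,r_{b-1}$ are not splits. A walk is safe if it is a subwalk of every closed walk of $G$ containing all nodes of $G$. A walk is multi-safe if for every set of proper closed walks of $G$ such that every node lies on at least one of them, the walk is a subwalk of some walk in the set. -}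

module Defs where

open import Data.Nat using (ℕ; _≤_)
open import Data.Fin using (Fin)
open import Data.Bool using (Bool; true)
open import Data.List using (List; []; _∷_; _++_; [_]; length; drop; take; concat; replicate)
open import Data.List.Membership.Propositional using (_∈_)
open import Data.List.Relation.Unary.All using (All)
open import Data.List.Relation.Unary.Unique.Propositional using (Unique)
open import Data.Product using (Σ; ∃; ∃-syntax; _×_)
open import Data.Sum using (_⊎_)
open import Relation.Nullary using (¬_)
open import Relation.Binary.PropositionalEquality using (_≡_; _≢_)
open import Function.Bundles using (_⇔_)

record Graph : Set where
  field
    n : ℕ
    E : Fin n → Fin n → Bool

module _ (G : Graph) where
  open Graph G

  Node : Set
  Node = Fin n

  Arc : Node → Node → Set
  Arc u v = E u v ≡ true

  data IsWalk : List Node → Set where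
    single : (x : Node) → IsWalk [ x ]
    cons   : {x y : Node} {xs : List Node} → Arc x y → IsWalk (y ∷ xs) → IsWalk (x ∷ y ∷ xs)

  Reach : Node → Node → Set
  Reach u v = u ≡ v ⊎ (∃[ ws ] IsWalk (u ∷ ws ++ [ v ]))

  StronglyConnected : Set
  StronglyConnected = (u v : Node) → Reach u v

  IsClosedWalk : List Node → Set
  IsClosedWalk C = IsWalk C × (Σ Node λ x → C ≡ [ x ] ⊎ (∃[ ys ] C ≡ x ∷ ys ++ [ x ]))

  IsProperClosedWalk : List Node → Set
  IsProperClosedWalk C = IsWalk C × (Σ Node λ x → ∃[ ys ] C ≡ x ∷ ys ++ [ x ])

  IsCycle : Set
  IsCycle = Σ Node λ x → ∃[ ys ]
      IsWalk (x ∷ ys ++ [ x ])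
    × Unique (x ∷ ys)
    × ((v : Node) → v ∈ x ∷ ys)
    × ((u v : Node) → Arc u v → ∃[ pre ] ∃[ suf ] x ∷ ys ++ [ x ] ≡ pre ++ u ∷ v ∷ suf)

  Infix : List Node → List Node → Set
  Infix W C = ∃[ pre ] ∃[ suf ] C ≡ pre ++ W ++ suf

  -- Subwalk of a closed walk: contiguous, possibly wrapping around the end
  -- (any number of times).  For C = x ∷ ys ++ [x] the cyclic sequence is x ∷ ys.
  SubwalkOfClosed : List Node → List Node → Set
  SubwalkOfClosed W C =
    Infix W C ⊎ (Σ Node λ x → ∃[ ys ] ∃[ k ]
                   C ≡ x ∷ ys ++ [ x ] × Infix W (concat (replicate k (x ∷ ys))))

  Split : Node → Set
  Split x = ∃[ u ] ∃[ v ] u ≢ v × Arc x u × Arc x v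

  Join : Node → Set
  Join x = ∃[ u ] ∃[ v ] u ≢ v × Arc u x × Arc v x

  NotJoin NotSplit : Node → Set
  NotJoin x = ¬ Join x
  NotSplit x = ¬ Split x

  lastL : List Node → List Node
  lastL []           = []
  lastL (x ∷ [])     = [ x ]
  lastL (x ∷ y ∷ xs) = lastL (y ∷ xs)

  dropLast : List Node → List Node
  dropLast []           = []
  dropLast (x ∷ [])     = []
  dropLast (x ∷ y ∷ xs) = x ∷ dropLast (y ∷ xs)

  -- L = (l_1..l_a), R = (r_1..r_b) form an admissible extension of W:
  -- L ++ W ++ R is a walk, l_2..l_a,w_1 are not joins, w_ℓ,r_1..r_{b-1} are not splits.
  AdmissibleExt : List Node → List Node → List Node → Set
  AdmissibleExt W L R =
      IsWalk (L ++ W ++ R)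
    × All NotJoin (drop 1 (L ++ take 1 W))
    × All NotSplit (dropLast (lastL W ++ R))

  IsUnivocalExtension : List Node → List Node → Set
  IsUnivocalExtension W U = ∃[ L ] ∃[ R ]
      U ≡ L ++ W ++ R
    × AdmissibleExt W L R
    × ((L' R' : List Node) → AdmissibleExt W L' R' → length L' ≤ length L × length R' ≤ length R)

  Safe : List Node → Set
  Safe W = (C : List Node) → IsClosedWalk C → ((v : Node) → v ∈ C) → SubwalkOfClosed W C

  MultiSafe : List Node → Set₁
  MultiSafe W = (S : List Node → Set)
    → ((C : List Node) → S C → IsProperClosedWalk C)
    → ((v : Node) → ∃[ C ] S C × v ∈ C)
    → ∃[ C ] S C × SubwalkOfClosed W C

{-# OPTIONS --safe #-}
-- Since W is a subwalk of U, (multi-)safety of U passes to W.  Conversely, let W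
-- occur in a closed walk C = x ∷ ys ++ [ x ] of positive length, read cyclically,
-- i.e. in some power (x ∷ ys)ᵏ.  In the power of one higher exponent the occurrence
-- has a predecessor, an in-neighbour of the first node of W; if that node is not a
-- join, the predecessor is forced to be the last node of L.  Repeating, and
-- symmetrically on the right with non-splits, the occurrence grows to one of
-- L ++ W ++ R.  The only covering closed walks of length 0 live in a one-node
-- graph, where any walk with an arc uses a loop and G would be a cycle.
module Submission where

open import Defs
open import Data.Product using (_×_)
open import Data.List using (List)
open import Relation.Nullary using (¬_)
open import Function.Bundles using (_⇔_)

open import Data.Nat using (ℕ; zero; suc)
open import Data.Fin.Properties using (_≟_)
open import Data.List using ([]; _∷_; _++_; [_]; concat; replicate; drop)
open import Data.List.Properties using (++-assoc; ++-identityʳ; ++-conicalʳ; ∷ʳ-injective)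
open import Data.List.Relation.Unary.All using (All; []; _∷_)
open import Data.List.Relation.Unary.Any using (here)
open import Data.List.Relation.Unary.AllPairs using ([]; _∷_)
open import Data.List.Membership.Propositional using (_∈_)
open import Data.Product using (∃-syntax; ∃₂; _,_)
open import Data.Sum using (inj₁; inj₂)
open import Data.Empty using (⊥-elim)
open import Relation.Nullary.Decidable using (decidable-stable)
open import Relation.Binary.PropositionalEquality
  using (_≡_; refl; sym; trans; cong; cong₂; subst; subst₂; module ≡-Reasoning)
open import Function.Bundles using (mk⇔)

module _ (G : Graph) where

  private
    Nodes : Set
    Nodes = List (Node G)

  snoc-lastL : ∀ w (W : Nodes) → ∃₂ λ V v → w ∷ W ≡ V ++ [ v ] × lastL G (w ∷ W) ≡ [ v ]
  snoc-lastL w []       = [] , w , refl , refl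
  snoc-lastL w (w′ ∷ W) with snoc-lastL w′ W
  ... | V , v , eq , last = w ∷ V , v , cong (w ∷_) eq , last

  walk-++ : ∀ (A : Nodes) {z B} → IsWalk G (A ++ [ z ]) → IsWalk G (z ∷ B) → IsWalk G (A ++ z ∷ B)
  walk-++ []           _           q = q
  walk-++ (a ∷ [])     (cons p _)  q = cons p q
  walk-++ (a ∷ a′ ∷ A) (cons p ps) q = cons p (walk-++ (a′ ∷ A) ps q)

  walk-arc : ∀ (A : Nodes) {a b B} → IsWalk G (A ++ a ∷ b ∷ B) → Arc G a b
  walk-arc []           (cons p _)  = p
  walk-arc (_ ∷ [])     (cons _ ps) = walk-arc [] ps
  walk-arc (_ ∷ a ∷ A)  (cons _ ps) = walk-arc (a ∷ A) ps

  walk-suffix : ∀ (A : Nodes) {b B} → IsWalk G (A ++ b ∷ B) → IsWalk G (b ∷ B)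
  walk-suffix []          p          = p
  walk-suffix (_ ∷ [])    (cons _ p) = p
  walk-suffix (_ ∷ a ∷ A) (cons _ p) = walk-suffix (a ∷ A) p

  walk-lastL : ∀ w (W R : Nodes) → IsWalk G ((w ∷ W) ++ R) → IsWalk G (lastL G (w ∷ W) ++ R)
  walk-lastL w []       R p          = p
  walk-lastL w (w′ ∷ W) R (cons _ p) = walk-lastL w′ W R p

  notJoin⇒unique-pred : ∀ {p l u} → NotJoin G u → Arc G p u → Arc G l u → p ≡ l
  notJoin⇒unique-pred {p} {l} nj pu lu =
    decidable-stable (p ≟ l) λ p≢l → nj (p , l , p≢l , pu , lu)

  notSplit⇒unique-succ : ∀ {v s r} → NotSplit G v → Arc G v s → Arc G v r → s ≡ r
  notSplit⇒unique-succ {_} {s} {r} ns vs vr =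
    decidable-stable (s ≟ r) λ s≢r → ns (s , r , s≢r , vs , vr)

  infix-++ˡ⁻ : ∀ (A : Nodes) {V T} → Infix G (A ++ V) T → Infix G V T
  infix-++ˡ⁻ A {V} (pre , suf , refl) = pre ++ A , suf ,
    trans (cong (pre ++_) (++-assoc A V suf)) (sym (++-assoc pre A (V ++ suf)))

  infix-++ʳ⁻ : ∀ {V} (B : Nodes) {T} → Infix G (V ++ B) T → Infix G V T
  infix-++ʳ⁻ {V} B (pre , suf , refl) = pre , B ++ suf , cong (pre ++_) (++-assoc V B suf)

  infix-++ʳ⁺ : ∀ {V T} (S : Nodes) → Infix G V T → Infix G V (T ++ S)
  infix-++ʳ⁺ {V} S (pre , suf , refl) =
    pre , suf ++ S , trans (++-assoc pre (V ++ suf) S) (cong (pre ++_) (++-assoc V suf S))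

  infix-walk-arc : ∀ {a b V T} (B : Nodes) → IsWalk G (T ++ B) → Infix G (a ∷ b ∷ V) T → Arc G a b
  infix-walk-arc {V = V} B p (pre , suf , refl) =
    walk-arc pre (subst (IsWalk G) reassoc p)
    where
    reassoc : (pre ++ (_ ∷ _ ∷ V) ++ suf) ++ B ≡ pre ++ _ ∷ _ ∷ V ++ suf ++ B
    reassoc = trans (++-assoc pre _ B) (cong (λ Z → pre ++ _ ∷ _ ∷ Z) (++-assoc V suf B))

  infix-predecessor : ∀ a (as : Nodes) {u V T} → Infix G (u ∷ V) T
                    → ∃[ p ] Infix G (p ∷ u ∷ V) ((a ∷ as) ++ T)
  infix-predecessor a as {u} {V} (pre , suf , refl) with snoc-lastL a (as ++ pre)
  ... | bs , p , eq , _ = p , bs , suf , (begin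
      (a ∷ as) ++ pre ++ u ∷ V ++ suf  ≡⟨ ++-assoc (a ∷ as) pre _ ⟨
      (a ∷ as ++ pre) ++ u ∷ V ++ suf  ≡⟨ cong (_++ u ∷ V ++ suf) eq ⟩
      (bs ++ [ p ]) ++ u ∷ V ++ suf    ≡⟨ ++-assoc bs [ p ] _ ⟩
      bs ++ p ∷ u ∷ V ++ suf           ∎)
    where open ≡-Reasoning

  infix-successor : ∀ a (as : Nodes) {V v T} → Infix G (V ++ [ v ]) T
                  → ∃[ s ] Infix G (V ++ v ∷ [ s ]) (T ++ a ∷ as)
  infix-successor a as {V} {v} (pre , suf , refl) with suf ++ a ∷ as in eq
  ... | s ∷ S = s , pre , S , (begin
      (pre ++ (V ++ [ v ]) ++ suf) ++ a ∷ as  ≡⟨ ++-assoc pre _ (a ∷ as) ⟩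
      pre ++ ((V ++ [ v ]) ++ suf) ++ a ∷ as  ≡⟨ cong (pre ++_) (++-assoc (V ++ [ v ]) suf (a ∷ as)) ⟩
      pre ++ (V ++ [ v ]) ++ suf ++ a ∷ as    ≡⟨ cong (λ Z → pre ++ (V ++ [ v ]) ++ Z) eq ⟩
      pre ++ (V ++ [ v ]) ++ s ∷ S            ≡⟨ cong (pre ++_) (++-assoc V [ v ] (s ∷ S)) ⟩
      pre ++ V ++ v ∷ s ∷ S                   ≡⟨ cong (pre ++_) (++-assoc V (v ∷ [ s ]) S) ⟨
      pre ++ (V ++ v ∷ [ s ]) ++ S            ∎)
    where open ≡-Reasoning
  ... | [] with () ← ++-conicalʳ suf (a ∷ as) eq

  subwalk-++⁻ : ∀ (L : Nodes) {W} R {C} → SubwalkOfClosed G (L ++ W ++ R) C → SubwalkOfClosed G W C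
  subwalk-++⁻ L R (inj₁ occ) = inj₁ (infix-++ʳ⁻ R (infix-++ˡ⁻ L occ))
  subwalk-++⁻ L R (inj₂ (x , ys , k , eq , occ)) =
    inj₂ (x , ys , k , eq , infix-++ʳ⁻ R (infix-++ˡ⁻ L occ))

  module Unrolling (x : Node G) (ys : Nodes) (cw : IsWalk G (x ∷ ys ++ [ x ])) where

    power : ℕ → Nodes
    power k = concat (replicate k (x ∷ ys))

    CyclicInfix : Nodes → Set
    CyclicInfix V = ∃[ k ] Infix G V (power k)

    power-suc : ∀ k → power (suc k) ≡ power k ++ x ∷ ys
    power-suc zero    = ++-identityʳ (x ∷ ys)
    power-suc (suc k) = trans (cong ((x ∷ ys) ++_) (power-suc k)) (sym (++-assoc (x ∷ ys) (power k) _))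

    power-walk : ∀ k → IsWalk G (power k ++ [ x ])
    power-walk zero    = single x
    power-walk (suc k) = subst (IsWalk G) (sym eq) (walk-++ (power k) (power-walk k) cw)
      where
      eq : power (suc k) ++ [ x ] ≡ power k ++ x ∷ ys ++ [ x ]
      eq = trans (cong (_++ [ x ]) (power-suc k)) (++-assoc (power k) (x ∷ ys) [ x ])

    closed-infix⇒cyclic : ∀ {V} → Infix G V (x ∷ ys ++ [ x ]) → CyclicInfix V
    closed-infix⇒cyclic occ =
      2 , subst (Infix G _) (++-assoc (x ∷ ys) [ x ] (ys ++ [])) (infix-++ʳ⁺ (ys ++ []) occ)

    subwalk⇒cyclic : ∀ {V C} → C ≡ x ∷ ys ++ [ x ] → SubwalkOfClosed G V C → CyclicInfix V
    subwalk⇒cyclic refl (inj₁ occ) = closed-infix⇒cyclic occ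
    subwalk⇒cyclic refl (inj₂ (x′ , ys′ , k , eq , occ)) with ∷ʳ-injective (x ∷ ys) (x′ ∷ ys′) eq
    ... | refl , refl = k , occ

    cons-cyclic : ∀ {l u V} → CyclicInfix (u ∷ V) → Arc G l u → NotJoin G u
                → CyclicInfix (l ∷ u ∷ V)
    cons-cyclic {l} {u} {V} (k , occ) lu nj with infix-predecessor x ys occ
    ... | p , occ′ = suc k , subst (λ q → Infix G (q ∷ u ∷ V) (power (suc k))) p≡l occ′
      where
      p≡l : p ≡ l
      p≡l = notJoin⇒unique-pred nj (infix-walk-arc [ x ] (power-walk (suc k)) occ′) lu

    snoc-cyclic : ∀ {V v r} → CyclicInfix (V ++ [ v ]) → Arc G v r → NotSplit G v
                → CyclicInfix (V ++ v ∷ [ r ])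
    snoc-cyclic {V} {v} {r} (k , occ) vr ns with infix-successor x ys occ
    ... | s , occ′ = suc k , subst₂ (λ q T → Infix G (V ++ v ∷ [ q ]) T) s≡r (sym (power-suc k)) occ′
      where
      walk : IsWalk G ((power k ++ x ∷ ys) ++ [ x ])
      walk = subst (λ T → IsWalk G (T ++ [ x ])) (power-suc k) (power-walk (suc k))
      s≡r : s ≡ r
      s≡r = notSplit⇒unique-succ ns (infix-walk-arc [ x ] walk (infix-++ˡ⁻ V occ′)) vr

    prepend-cyclic : ∀ (L : Nodes) v V → CyclicInfix (v ∷ V) → IsWalk G (L ++ v ∷ V)
                   → All (NotJoin G) (drop 1 (L ++ [ v ])) → CyclicInfix (L ++ v ∷ V)
    prepend-cyclic []           v V occ _           _          = occ
    prepend-cyclic (l ∷ [])     v V occ (cons lv _) (nj ∷ _)   = cons-cyclic occ lv nj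
    prepend-cyclic (l ∷ l′ ∷ L) v V occ (cons ll p) (nj ∷ njs) =
      cons-cyclic (prepend-cyclic (l′ ∷ L) v V occ p njs) ll nj

    append-cyclic : ∀ (R V : Nodes) v → CyclicInfix (V ++ [ v ]) → IsWalk G (v ∷ R)
                  → All (NotSplit G) (dropLast G (v ∷ R)) → CyclicInfix (V ++ v ∷ R)
    append-cyclic []      V v occ _           _          = occ
    append-cyclic (r ∷ R) V v occ (cons vr p) (ns ∷ nss) =
      subst CyclicInfix (++-assoc V [ v ] (r ∷ R))
        (append-cyclic R (V ++ [ v ]) r
          (subst CyclicInfix (sym (++-assoc V [ v ] [ r ])) (snoc-cyclic occ vr ns)) p nss)

    append-cyclic-lastL : ∀ (R : Nodes) w W → CyclicInfix (w ∷ W) → IsWalk G (lastL G (w ∷ W) ++ R)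
                        → All (NotSplit G) (dropLast G (lastL G (w ∷ W) ++ R)) → CyclicInfix ((w ∷ W) ++ R)
    append-cyclic-lastL R w W occ p nss with snoc-lastL w W
    ... | V , v , eq , last rewrite last =
      subst CyclicInfix (trans (sym (++-assoc V [ v ] R)) (cong (_++ R) (sym eq)))
        (append-cyclic R V v (subst CyclicInfix eq occ) p nss)

    cons-admissible-cyclic : ∀ w W {L R} → AdmissibleExt G (w ∷ W) L R → CyclicInfix (w ∷ W)
                           → CyclicInfix (L ++ (w ∷ W) ++ R)
    cons-admissible-cyclic w W {L} {R} (p , njs , nss) occ =
      prepend-cyclic L w (W ++ R)
        (append-cyclic-lastL R w W occ (walk-lastL w W R (walk-suffix L p)) nss) p njs

    admissible-cyclic : ∀ (L : Nodes) {W} R → IsWalk G W → AdmissibleExt G W L R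
                      → CyclicInfix W → CyclicInfix (L ++ W ++ R)
    admissible-cyclic L R (single w)              = cons-admissible-cyclic w [] {L} {R}
    admissible-cyclic L R (cons {w} {w′} {W} _ _) = cons-admissible-cyclic w (w′ ∷ W) {L} {R}

  admissible-subwalk : ∀ (L : Nodes) {W} R {C} → IsProperClosedWalk G C → IsWalk G W
                     → AdmissibleExt G W L R → SubwalkOfClosed G W C → SubwalkOfClosed G (L ++ W ++ R) C
  admissible-subwalk L R (p , x , ys , refl) w adm sub
    with Unrolling.admissible-cyclic x ys p L R w adm (Unrolling.subwalk⇒cyclic x ys p refl sub)
  ... | k , occ = inj₂ (x , ys , k , refl , occ)

  covering-singleton : ∀ {x} → ((v : Node G) → v ∈ [ x ]) → ∀ v → v ≡ x
  covering-singleton cover v with cover v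
  ... | here v≡x = v≡x

  loop⇒isCycle : ∀ {x} → (∀ v → v ≡ x) → Arc G x x → IsCycle G
  loop⇒isCycle {x} all≡x loop =
    x , [] , cons loop (single x) , [] ∷ [] , (λ v → here (all≡x v)) ,
    λ u v _ → [] , [] , cong₂ (λ a b → a ∷ b ∷ []) (sym (all≡x u)) (sym (all≡x v))

  walk-in-one-node : ∀ {x U} → ¬ IsCycle G → (∀ v → v ≡ x) → IsWalk G U → U ≡ [ x ]
  walk-in-one-node _      all≡x (single u)          = cong [_] (all≡x u)
  walk-in-one-node ¬cycle all≡x (cons {a} {b} ab _) =
    ⊥-elim (¬cycle (loop⇒isCycle all≡x (subst₂ (Arc G) (all≡x a) (all≡x b) ab)))

  Safe-++⁻ : ∀ (L : Nodes) {W} R → Safe G (L ++ W ++ R) → Safe G W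
  Safe-++⁻ L {W} R safe C closed cover = subwalk-++⁻ L {W} R (safe C closed cover)

  MultiSafe-++⁻ : ∀ (L : Nodes) {W} R → MultiSafe G (L ++ W ++ R) → MultiSafe G W
  MultiSafe-++⁻ L {W} R safe S proper cover with safe S proper cover
  ... | C , C∈S , sub = C , C∈S , subwalk-++⁻ L {W} R sub

  admissible-Safe : ∀ (L : Nodes) {W} R → ¬ IsCycle G → IsWalk G W → AdmissibleExt G W L R
                  → Safe G W → Safe G (L ++ W ++ R)
  admissible-Safe L R ¬cycle _ (p , _) _ _ (_ , x , inj₁ refl) cover =
    subst (λ U → SubwalkOfClosed G U [ x ]) (sym U≡[x]) (inj₁ ([] , [] , refl))
    where
    U≡[x] : L ++ _ ++ R ≡ [ x ]
    U≡[x] = walk-in-one-node ¬cycle (covering-singleton cover) p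
  admissible-Safe L R ¬cycle w adm safe C closed@(p , x , inj₂ (ys , eq)) cover =
    admissible-subwalk L R (p , x , ys , eq) w adm (safe C closed cover)

  admissible-MultiSafe : ∀ (L : Nodes) {W} R → IsWalk G W → AdmissibleExt G W L R
                       → MultiSafe G W → MultiSafe G (L ++ W ++ R)
  admissible-MultiSafe L R w adm safe S proper cover with safe S proper cover
  ... | C , C∈S , sub = C , C∈S , admissible-subwalk L R (proper C C∈S) w adm sub

lemma16 : (G : Graph) → StronglyConnected G → ¬ IsCycle G
    → (W U : List (Node G)) → IsWalk G W → IsUnivocalExtension G W U
    → (Safe G U ⇔ Safe G W) × (MultiSafe G U ⇔ MultiSafe G W)
lemma16 G _ ¬cycle W U w (L , R , refl , adm , _) =
  mk⇔ (Safe-++⁻ G L R) (admissible-Safe G L R ¬cycle w adm) ,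
  mk⇔ (MultiSafe-++⁻ G L R) (admissible-MultiSafe G L R w adm)
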